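{- Let $A=\frac{1}{1-RX}(1)=\sum_{m\ge0}R^m(1)X^m$ and $B=\frac{1}{1-RY}(1)=\sum_{m\ge0}R^m(1)Y^m$. In $\mathfrak{H}^1_\diamond[[X,Y]]$ the identity $$(1-RX)(1-RY)\bigl(A\diamond B\bigr)=1+XY\Bigl(y\diamond R(A\diamond B)-R\bigl(y\diamond A\diamond B\bigr)\Bigr)$$ holds, where $(1-RX)(1-RY)$ denotes the operator $\mathrm{id}-(X+Y)R+XYR^2$.
   Context: $\mathfrak{H}=\mathbb{Q}\langle x,y\rangle$, $z=x+y$. The product $\diamond$ on $\mathfrak{H}$ is the $\mathbb{Q}$-bilinear product with $w\diamond1=1\diamond w=w$ and, for $v,w\in\mathfrak{H}$: $vx\diamond wx=(v\diamond wx)x-(vy\diamond w)x$, $vx\diamond wy=(v\diamond wy)x+(vx\diamond w)y$, $vy\diamond wx=(v\diamond wx)y+(vy\diamond w)x$, $vy\diamond wy=(v\diamond wy)y-(vx\diamond w)y$. $\mathfrak{H}^1_\diamond$ is $\mathfrak{H}^1=\mathbb{Q}+\mathfrak{H}y$ with this (associative, commutative) product. $X,Y$ are commuting formal parameters commuting with $x,y$; $\diamond$ and linear maps are extended coefficientwise to power series in $X,Y$. $R=R_yR_{z+y}R_y^{ -1}$ is the linear map on $\mathfrak{H}^1$ with $R(wy)=w(x+2y)y$ for $w\in\mathfrak{H}$, and $R(1)=y$. -}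

module Defs where

open import Data.Nat using (ℕ; zero; suc; _∸_)
open import Data.Rational using (ℚ; 0ℚ; 1ℚ; -_; _+_; _*_)
open import Data.List using (List; []; _∷_; _++_; map; concatMap; upTo)
open import Data.Product using (_×_; _,_)
open import Relation.Binary.PropositionalEquality using (_≡_; refl)
open import Relation.Nullary using (Dec; yes; no)
open import Function using (id)

-- The free algebra 𝔥 = ℚ⟨x,y⟩.
-- CONVENTION: a word is stored REVERSED, i.e. the head of the list is the
-- LAST (rightmost) letter.  So the word  w·ℓ  is  ℓ ∷ w.

data Letter : Set where
  lx ly : Letter

Word : Set
Word = List Letter

_≟ℓ_ : (a b : Letter) → Dec (a ≡ b)
lx ≟ℓ lx = yes refl
lx ≟ℓ ly = no λ ()
ly ≟ℓ lx = no λ ()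
ly ≟ℓ ly = yes refl

_≟w_ : (u v : Word) → Dec (u ≡ v)
[] ≟w [] = yes refl
[] ≟w (_ ∷ _) = no λ ()
(_ ∷ _) ≟w [] = no λ ()
(a ∷ u) ≟w (b ∷ v) with a ≟ℓ b | u ≟w v
... | yes refl | yes refl = yes refl
... | no a≢b | _ = no λ { refl → a≢b refl }
... | yes _ | no u≢v = no λ { refl → u≢v refl }

Poly : Set
Poly = List (ℚ × Word)

coeff : Word → Poly → ℚ
coeff w [] = 0ℚ
coeff w ((q , u) ∷ p) with u ≟w w
... | yes _ = q + coeff w p
... | no _  = coeff w p

_≈P_ : Poly → Poly → Set
p ≈P p' = ∀ w → coeff w p ≡ coeff w p'

0P : Poly
0P = []

mono : Word → Poly
mono w = (1ℚ , w) ∷ []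

1P : Poly
1P = mono []

yP : Poly
yP = mono (ly ∷ [])

_⊕_ : Poly → Poly → Poly
_⊕_ = _++_

scale : ℚ → Poly → Poly
scale c = map (λ (q , w) → (c * q , w))

negP : Poly → Poly
negP = scale (- 1ℚ)

_⊖_ : Poly → Poly → Poly
p ⊖ p' = p ⊕ negP p'

_·ℓ_ : Poly → Letter → Poly
p ·ℓ l = map (λ (q , w) → (q , l ∷ w)) p

_⋄w_ : Word → Word → Poly
[] ⋄w w = mono w
(l ∷ v) ⋄w [] = mono (l ∷ v)
(lx ∷ v) ⋄w (lx ∷ w) = ((v ⋄w (lx ∷ w)) ⊖ ((ly ∷ v) ⋄w w)) ·ℓ lx
(lx ∷ v) ⋄w (ly ∷ w) = ((v ⋄w (ly ∷ w)) ·ℓ lx) ⊕ (((lx ∷ v) ⋄w w) ·ℓ ly)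
(ly ∷ v) ⋄w (lx ∷ w) = ((v ⋄w (lx ∷ w)) ·ℓ ly) ⊕ (((ly ∷ v) ⋄w w) ·ℓ lx)
(ly ∷ v) ⋄w (ly ∷ w) = ((v ⋄w (ly ∷ w)) ⊖ ((lx ∷ v) ⋄w w)) ·ℓ ly

_⋄_ : Poly → Poly → Poly
p ⋄ p' = concatMap (λ (a , u) → concatMap (λ (b , v) → scale (a * b) (u ⋄w v)) p') p

linExt : (Word → Poly) → Poly → Poly
linExt f p = concatMap (λ (q , w) → scale q (f w)) p

2ℚ : ℚ
2ℚ = 1ℚ + 1ℚ

-- R on 𝔥¹:  R(1) = y,  R(wy) = w(x+2y)y = wxy + 2wyy.
-- R is only defined on 𝔥¹ = ℚ + 𝔥y; words ending in x are sent to 0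
-- (junk value, never used: all arguments below lie in 𝔥¹).
Rw : Word → Poly
Rw [] = mono (ly ∷ [])
Rw (ly ∷ w) = (1ℚ , ly ∷ lx ∷ w) ∷ (2ℚ , ly ∷ ly ∷ w) ∷ []
Rw (lx ∷ w) = 0P

R : Poly → Poly
R = linExt Rw

iter : ℕ → (Poly → Poly) → Poly → Poly
iter zero f p = p
iter (suc n) f p = f (iter n f p)

-- Formal power series in the commuting variables X, Y with coefficients
-- in 𝔥:  s a b  is the coefficient of X^a Y^b.

Series : Set
Series = ℕ → ℕ → Poly

_≈S_ : Series → Series → Set
s ≈S t = ∀ a b → s a b ≈P t a b

constS : Poly → Series
constS p zero zero = p
constS p _ _ = 0P

_⊕S_ : Series → Series → Series
(s ⊕S t) a b = s a b ⊕ t a b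

_⊖S_ : Series → Series → Series
(s ⊖S t) a b = s a b ⊖ t a b

X·_ : Series → Series
(X· s) zero b = 0P
(X· s) (suc a) b = s a b

Y·_ : Series → Series
(Y· s) a zero = 0P
(Y· s) a (suc b) = s a b

mapS : (Poly → Poly) → Series → Series
mapS f s a b = f (s a b)

RS : Series → Series
RS = mapS R

_⋄S_ : Series → Series → Series
(s ⋄S t) a b =
  concatMap (λ i → concatMap (λ j → s i j ⋄ t (a ∸ i) (b ∸ j)) (upTo (suc b)))
            (upTo (suc a))

seriesA : Series
seriesA a zero = iter a R 1P
seriesA a (suc b) = 0P

seriesB : Series
seriesB zero b = iter b R 1P
seriesB (suc a) b = 0P

opRXRY : Series → Series
opRXRY s = ((s ⊖S (X· RS s)) ⊖S (Y· RS s)) ⊕S (X· (Y· RS (RS s)))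

-- Comparing coefficients of X^(a+1) Y^(b+1), with U = R^a(1) and V = R^b(1), the identity reads
--   RU⋄RV − R(U⋄RV) − R(RU⋄V) + R²(U⋄V) = y⋄R(U⋄V) − R(y⋄(U⋄V)),
-- while the coefficients on the axes only need 1⋄W = W⋄1 = W. As R^a(1) is 1 or lies in 𝔥y,
-- it suffices to treat U = 1 and V = 1 (by R(1) = y and W⋄y = y⋄W) and U = py, V = qy.
-- In the last case both sides are expanded with
--   R(my) = (my + mz)y,   (uz)⋄v = u⋄(vz) = (u⋄v)z,   uy⋄vy = (u⋄vy + uy⋄v − (u⋄v)z)y
-- into ℤ-combinations of p⋄q, p⋄V, U⋄q, p⋄RV and RU⋄q followed by words in x, y, and the
-- two combinations coincide. The rules for ⋄ hold on words by its recursive definition and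
-- extend bilinearly.

module Submission where

-- Defs declares no fixities for these operators.
open import Defs renaming (_⊕_ to infixl 6 _⊕_; _⊖_ to infixl 6 _⊖_; _⋄_ to infixl 7 _⋄_; _⋄w_ to infixl 7 _⋄w_; _·ℓ_ to infixl 8 _·ℓ_)
open import Data.Bool using (Bool; true; false; not)
import Data.Bool.Properties as Bool
open import Data.Fin using (Fin; #_)
import Data.Fin.Properties as Fin
open import Data.List using (List; []; _∷_; _++_; map; concatMap; length; filter; upTo)
open import Data.List.Properties using (length-filter; ++-assoc; ++-identityʳ; map-++; map-upTo; concatMap-map)
open import Data.Maybe using (Maybe; just; nothing)
open import Data.Nat using (ℕ; zero; suc; _≤_; _<_; _∸_; z≤n; s≤s; pred)
open import Data.Nat.Properties using (≤-refl; ≤-trans; ≤∧≢⇒<; n∸n≡0; m<n⇒0<n∸m)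
open import Data.Product using (Σ; _×_; _,_; proj₂)
open import Data.Product.Properties using (≡-dec)
open import Data.Rational using (ℚ; 0ℚ; 1ℚ; -_; _+_; _*_)
open import Data.Rational.Properties using (+-identityˡ; +-assoc; +-comm; *-zeroˡ; *-zeroʳ; *-identityʳ; *-distribˡ-+)
open import Data.Rational.Solver using (module +-*-Solver)
open +-*-Solver using (solve; _:+_; _:*_; :-_; con; _:=_)
open import Data.Vec using (Vec; lookup; []; _∷_)
open import Data.Vec.Relation.Unary.All using (All; []; _∷_)
open import Data.Vec.Relation.Unary.All.Properties using (lookup⁺)
open import Function using (_∘_)
open import Relation.Binary.Bundles using (Setoid)
open import Relation.Binary.PropositionalEquality
import Relation.Binary.Reasoning.Setoid as SetoidReasoning
open import Relation.Nullary using (Dec; yes; no; ¬_; ¬?)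

-- Polynomials as a ℚ-vector space

-- A record, unlike _≈P_, lets Agda infer both polynomials from a proof.
infix 4 _≈_
record _≈_ (p q : Poly) : Set where
  constructor mk≈
  field at : ∀ w → coeff w p ≡ coeff w q
open _≈_ public

≈-refl : ∀ {p} → p ≈ p
≈-refl = mk≈ λ _ → refl

≈-reflexive : ∀ {p q} → p ≡ q → p ≈ q
≈-reflexive refl = ≈-refl

≈-sym : ∀ {p q} → p ≈ q → q ≈ p
≈-sym e = mk≈ λ w → sym (at e w)

≈-trans : ∀ {p q r} → p ≈ q → q ≈ r → p ≈ r
≈-trans e f = mk≈ λ w → trans (at e w) (at f w)

≈-setoid : Setoid _ _
≈-setoid = record
  { Carrier = Poly
  ; _≈_ = _≈_
  ; isEquivalence = record { refl = ≈-refl ; sym = ≈-sym ; trans = ≈-trans }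
  }

module ≈-Reasoning = SetoidReasoning ≈-setoid

coeff-≡ : ∀ {w u q p} → u ≡ w → coeff w ((q , u) ∷ p) ≡ q + coeff w p
coeff-≡ {w} {u} refl with u ≟w u
... | yes _ = refl
... | no u≢u with () ← u≢u refl

coeff-≢ : ∀ {w u q p} → ¬ (u ≡ w) → coeff w ((q , u) ∷ p) ≡ coeff w p
coeff-≢ {w} {u} u≢w with u ≟w w
... | yes u≡w with () ← u≢w u≡w
... | no _ = refl

coeff-++ : ∀ w p q → coeff w (p ++ q) ≡ coeff w p + coeff w q
coeff-++ w [] q = sym (+-identityˡ _)
coeff-++ w ((a , u) ∷ p) q with u ≟w w
... | yes _ = trans (cong (a +_) (coeff-++ w p q)) (sym (+-assoc a _ _))
... | no _ = coeff-++ w p q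

coeff-scale : ∀ w k p → coeff w (scale k p) ≡ k * coeff w p
coeff-scale w k [] = sym (*-zeroʳ k)
coeff-scale w k ((a , u) ∷ p) with u ≟w w
... | yes _ = trans (cong (k * a +_) (coeff-scale w k p)) (sym (*-distribˡ-+ k a _))
... | no _ = coeff-scale w k p

∷-cong : ∀ {a b u p q} → a ≡ b → p ≈ q → ((a , u) ∷ p) ≈ ((b , u) ∷ q)
∷-cong {a} {u = u} {p} {q} refl e = mk≈ λ w → lemma w
  where
  lemma : ∀ w → coeff w ((a , u) ∷ p) ≡ coeff w ((a , u) ∷ q)
  lemma w with u ≟w w
  ... | yes _ = cong (a +_) (at e w)
  ... | no _ = at e w

⊕-cong : ∀ {p p′ q q′} → p ≈ p′ → q ≈ q′ → p ⊕ q ≈ p′ ⊕ q′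
⊕-cong {p} {p′} {q} {q′} e f = mk≈ λ w → begin
  coeff w (p ⊕ q)             ≡⟨ coeff-++ w p q ⟩
  coeff w p + coeff w q       ≡⟨ cong₂ _+_ (at e w) (at f w) ⟩
  coeff w p′ + coeff w q′     ≡⟨ coeff-++ w p′ q′ ⟨
  coeff w (p′ ⊕ q′)           ∎
  where open ≡-Reasoning

scale-cong : ∀ k {p p′} → p ≈ p′ → scale k p ≈ scale k p′
scale-cong k {p} {p′} e = mk≈ λ w →
  trans (coeff-scale w k p) (trans (cong (k *_) (at e w)) (sym (coeff-scale w k p′)))

⊖-cong : ∀ {p p′ q q′} → p ≈ p′ → q ≈ q′ → p ⊖ q ≈ p′ ⊖ q′
⊖-cong e f = ⊕-cong e (scale-cong (- 1ℚ) f)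

⊕-assoc : ∀ p q r → (p ⊕ q) ⊕ r ≈ p ⊕ (q ⊕ r)
⊕-assoc p q r = ≈-reflexive (++-assoc p q r)

⊕-identityʳ : ∀ p → p ⊕ 0P ≈ p
⊕-identityʳ p = ≈-reflexive (++-identityʳ p)

⊖-identityʳ : ∀ p → p ⊖ 0P ≈ p
⊖-identityʳ = ⊕-identityʳ

⊕-leftComm : ∀ p q r → p ⊕ (q ⊕ r) ≈ q ⊕ (p ⊕ r)
⊕-leftComm p q r = mk≈ λ w → begin
  coeff w (p ⊕ (q ⊕ r))                 ≡⟨ coeff-++ w p (q ⊕ r) ⟩
  coeff w p + coeff w (q ⊕ r)           ≡⟨ cong (coeff w p +_) (coeff-++ w q r) ⟩
  coeff w p + (coeff w q + coeff w r)   ≡⟨ +-leftComm (coeff w p) (coeff w q) (coeff w r) ⟩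
  coeff w q + (coeff w p + coeff w r)   ≡⟨ cong (coeff w q +_) (coeff-++ w p r) ⟨
  coeff w q + coeff w (p ⊕ r)           ≡⟨ coeff-++ w q (p ⊕ r) ⟨
  coeff w (q ⊕ (p ⊕ r))                 ∎
  where
  open ≡-Reasoning
  +-leftComm : ∀ a b c → a + (b + c) ≡ b + (a + c)
  +-leftComm = solve 3 (λ a b c → a :+ (b :+ c) := b :+ (a :+ c)) refl

negP-involutive : ∀ p → negP (negP p) ≈ p
negP-involutive p = mk≈ λ w → begin
  coeff w (negP (negP p))     ≡⟨ coeff-scale w (- 1ℚ) (negP p) ⟩
  - 1ℚ * coeff w (negP p)     ≡⟨ cong (- 1ℚ *_) (coeff-scale w (- 1ℚ) p) ⟩
  - 1ℚ * (- 1ℚ * coeff w p)   ≡⟨ solve 1 (λ a → (:- con 1ℚ) :* ((:- con 1ℚ) :* a) := a) refl (coeff w p) ⟩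
  coeff w p                   ∎
  where open ≡-Reasoning

⊕-inverseʳ : ∀ p → p ⊕ negP p ≈ 0P
⊕-inverseʳ p = mk≈ λ w → begin
  coeff w (p ⊕ negP p)             ≡⟨ coeff-++ w p (negP p) ⟩
  coeff w p + coeff w (negP p)     ≡⟨ cong (coeff w p +_) (coeff-scale w (- 1ℚ) p) ⟩
  coeff w p + - 1ℚ * coeff w p     ≡⟨ solve 1 (λ a → a :+ (:- con 1ℚ) :* a := con 0ℚ) refl (coeff w p) ⟩
  0ℚ                               ∎
  where open ≡-Reasoning

⊕-inverseˡ : ∀ p → negP p ⊕ p ≈ 0P
⊕-inverseˡ p = ≈-trans (mk≈ λ w → trans (coeff-++ w (negP p) p)
  (trans (+-comm (coeff w (negP p)) (coeff w p)) (sym (coeff-++ w p (negP p)))))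
  (⊕-inverseʳ p)

⊖≈0⇒≈ : ∀ {p q} → p ⊖ q ≈ 0P → p ≈ q
⊖≈0⇒≈ {p} {q} e = mk≈ λ w → begin
  coeff w p
    ≡⟨ solve 2 (λ a b → a := a :+ (:- con 1ℚ) :* b :+ b) refl (coeff w p) (coeff w q) ⟩
  coeff w p + - 1ℚ * coeff w q + coeff w q
    ≡⟨ cong (λ c → coeff w p + c + coeff w q) (coeff-scale w (- 1ℚ) q) ⟨
  coeff w p + coeff w (negP q) + coeff w q
    ≡⟨ cong (_+ coeff w q) (trans (sym (coeff-++ w p (negP q))) (at e w)) ⟩
  0ℚ + coeff w q
    ≡⟨ +-identityˡ (coeff w q) ⟩
  coeff w q ∎
  where open ≡-Reasoning

-- Linear maps

-- A word may occur in several terms of p, so invariance of the pairing under ≈ (pairing-congˡ)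
-- takes an argument.
pairing : Poly → (Word → ℚ) → ℚ
pairing [] g = 0ℚ
pairing ((a , u) ∷ p) g = a * g u + pairing p g

pairing-++ : ∀ p q g → pairing (p ++ q) g ≡ pairing p g + pairing q g
pairing-++ [] q g = sym (+-identityˡ _)
pairing-++ ((a , u) ∷ p) q g =
  trans (cong (a * g u +_) (pairing-++ p q g)) (sym (+-assoc (a * g u) _ _))

pairing-scale : ∀ k p g → pairing (scale k p) g ≡ k * pairing p g
pairing-scale k [] g = sym (*-zeroʳ k)
pairing-scale k ((a , u) ∷ p) g = trans (cong (k * a * g u +_) (pairing-scale k p g))
  (solve 4 (λ k a x s → k :* a :* x :+ k :* s := k :* (a :* x :+ s)) refl k a (g u) _)

pairing-congʳ : ∀ p {g h} → (∀ u → g u ≡ h u) → pairing p g ≡ pairing p h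
pairing-congʳ [] e = refl
pairing-congʳ ((a , u) ∷ p) e = cong₂ (λ x y → a * x + y) (e u) (pairing-congʳ p e)

pairing-+ʳ : ∀ p g h → pairing p (λ u → g u + h u) ≡ pairing p g + pairing p h
pairing-+ʳ [] g h = sym (+-identityˡ _)
pairing-+ʳ ((a , u) ∷ p) g h = trans (cong (a * (g u + h u) +_) (pairing-+ʳ p g h))
  (solve 5 (λ a x y s t → a :* (x :+ y) :+ (s :+ t) := a :* x :+ s :+ (a :* y :+ t))
         refl a (g u) (h u) _ _)

pairing-*ʳ : ∀ p k g → pairing p (λ u → k * g u) ≡ k * pairing p g
pairing-*ʳ [] k g = sym (*-zeroʳ k)
pairing-*ʳ ((a , u) ∷ p) k g = trans (cong (a * (k * g u) +_) (pairing-*ʳ p k g))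
  (solve 4 (λ a k x s → a :* (k :* x) :+ k :* s := k :* (a :* x :+ s)) refl a k (g u) _)

pairing-0ʳ : ∀ p → pairing p (λ _ → 0ℚ) ≡ 0ℚ
pairing-0ʳ [] = refl
pairing-0ʳ ((a , u) ∷ p) =
  trans (cong₂ _+_ (*-zeroʳ a) (pairing-0ʳ p)) (+-identityˡ 0ℚ)

pairing-swap : ∀ p q (h : Word → Word → ℚ) →
  pairing p (λ u → pairing q (h u)) ≡ pairing q (λ v → pairing p (λ u → h u v))
pairing-swap [] q h = sym (pairing-0ʳ q)
pairing-swap ((a , u) ∷ p) q h = begin
  a * pairing q (h u) + pairing p (λ u → pairing q (h u))
    ≡⟨ cong (a * pairing q (h u) +_) (pairing-swap p q h) ⟩
  a * pairing q (h u) + pairing q (λ v → pairing p (λ u → h u v))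
    ≡⟨ cong (_+ pairing q (λ v → pairing p (λ u → h u v))) (pairing-*ʳ q a (h u)) ⟨
  pairing q (λ v → a * h u v) + pairing q (λ v → pairing p (λ u → h u v))
    ≡⟨ pairing-+ʳ q _ _ ⟨
  pairing q (λ v → a * h u v + pairing p (λ u → h u v)) ∎
  where open ≡-Reasoning

pairing-mono : ∀ u g → pairing (mono u) g ≡ g u
pairing-mono u g = solve 1 (λ x → con 1ℚ :* x :+ con 0ℚ := x) refl (g u)

coeff-pairing : ∀ w p → coeff w p ≡ pairing p (λ u → coeff w (mono u))
coeff-pairing w [] = refl
coeff-pairing w ((a , u) ∷ p) with u ≟w w
... | yes _ = cong₂ _+_ (solve 1 (λ a → a := a :* (con 1ℚ :+ con 0ℚ)) refl a) (coeff-pairing w p)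
... | no _ = trans (coeff-pairing w p)
                   (sym (trans (cong (_+ _) (*-zeroʳ a)) (+-identityˡ _)))

erase : Word → Poly → Poly
erase u = filter (λ t → ¬? (proj₂ t ≟w u))

pairing-erase : ∀ u p g → pairing p g ≡ coeff u p * g u + pairing (erase u p) g
pairing-erase u [] g = sym (trans (cong (_+ 0ℚ) (*-zeroˡ (g u))) (+-identityˡ 0ℚ))
pairing-erase u ((b , v) ∷ p) g with v ≟w u
... | yes refl = trans (cong (b * g v +_) (pairing-erase v p g))
  (solve 4 (λ b x c s → b :* x :+ (c :* x :+ s) := (b :+ c) :* x :+ s) refl b (g v) (coeff v p) _)
... | no _ = trans (cong (b * g v +_) (pairing-erase u p g))
  (solve 5 (λ b x c y s → b :* x :+ (c :* y :+ s) := c :* y :+ (b :* x :+ s))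
         refl b (g v) (coeff u p) (g u) _)

coeff-erase-≢ : ∀ {w u} p → ¬ (w ≡ u) → coeff w (erase u p) ≡ coeff w p
coeff-erase-≢ [] w≢u = refl
coeff-erase-≢ {w} {u} ((b , v) ∷ p) w≢u with v ≟w u
... | yes refl = trans (coeff-erase-≢ p w≢u) (sym (coeff-≢ (w≢u ∘ sym)))
... | no _ with v ≟w w
...   | yes _ = cong (b +_) (coeff-erase-≢ p w≢u)
...   | no _ = coeff-erase-≢ p w≢u

coeff-erase-≡ : ∀ u p → coeff u (erase u p) ≡ 0ℚ
coeff-erase-≡ u [] = refl
coeff-erase-≡ u ((b , v) ∷ p) with v ≟w u
... | yes _ = coeff-erase-≡ u p
... | no v≢u = trans (coeff-≢ v≢u) (coeff-erase-≡ u p)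

pairing-null : ∀ n p g → length p ≤ n → (∀ w → coeff w p ≡ 0ℚ) → pairing p g ≡ 0ℚ
pairing-null n [] g _ _ = refl
pairing-null (suc n) ((a , u) ∷ p) g (s≤s |p|≤n) null = begin
  a * g u + pairing p g
    ≡⟨ cong (a * g u +_) (pairing-erase u p g) ⟩
  a * g u + (coeff u p * g u + pairing (erase u p) g)
    ≡⟨ solve 4 (λ a x c s → a :* x :+ (c :* x :+ s) := (a :+ c) :* x :+ s) refl a (g u) (coeff u p) _ ⟩
  (a + coeff u p) * g u + pairing (erase u p) g
    ≡⟨ cong₂ (λ c s → c * g u + s) (trans (sym (coeff-≡ {u} {u} {a} {p} refl)) (null u))
             (pairing-null n (erase u p) g (≤-trans (length-filter _ p) |p|≤n) erased-null) ⟩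
  0ℚ * g u + 0ℚ
    ≡⟨ solve 1 (λ x → con 0ℚ :* x :+ con 0ℚ := con 0ℚ) refl (g u) ⟩
  0ℚ ∎
  where
  open ≡-Reasoning
  erased-null : ∀ w → coeff w (erase u p) ≡ 0ℚ
  erased-null w with w ≟w u
  ... | yes refl = coeff-erase-≡ w p
  ... | no w≢u = trans (coeff-erase-≢ p w≢u) (trans (sym (coeff-≢ (w≢u ∘ sym))) (null w))

pairing-congˡ : ∀ {p p′} g → p ≈ p′ → pairing p g ≡ pairing p′ g
pairing-congˡ {p} {p′} g e = begin
  pairing p g
    ≡⟨ solve 2 (λ a b → a := a :+ (:- con 1ℚ) :* b :+ b) refl (pairing p g) (pairing p′ g) ⟩
  pairing p g + (- 1ℚ) * pairing p′ g + pairing p′ g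
    ≡⟨ cong (λ x → pairing p g + x + pairing p′ g) (pairing-scale (- 1ℚ) p′ g) ⟨
  pairing p g + pairing (negP p′) g + pairing p′ g
    ≡⟨ cong (_+ pairing p′ g) (pairing-++ p (negP p′) g) ⟨
  pairing (p ⊖ p′) g + pairing p′ g
    ≡⟨ cong (_+ pairing p′ g) (pairing-null _ (p ⊖ p′) g ≤-refl difference-null) ⟩
  0ℚ + pairing p′ g
    ≡⟨ +-identityˡ _ ⟩
  pairing p′ g ∎
  where
  open ≡-Reasoning
  difference-null : ∀ w → coeff w (p ⊖ p′) ≡ 0ℚ
  difference-null w = begin
    coeff w (p ⊖ p′)                      ≡⟨ coeff-++ w p (negP p′) ⟩
    coeff w p + coeff w (negP p′)         ≡⟨ cong (coeff w p +_) (coeff-scale w (- 1ℚ) p′) ⟩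
    coeff w p + (- 1ℚ) * coeff w p′       ≡⟨ cong (λ c → coeff w p + (- 1ℚ) * c) (at e w) ⟨
    coeff w p + (- 1ℚ) * coeff w p        ≡⟨ solve 1 (λ a → a :+ (:- con 1ℚ) :* a := con 0ℚ) refl (coeff w p) ⟩
    0ℚ                                    ∎

coeff-linExt : ∀ w f X → coeff w (linExt f X) ≡ pairing X (λ u → coeff w (f u))
coeff-linExt w f [] = refl
coeff-linExt w f ((a , u) ∷ X) = trans (coeff-++ w (scale a (f u)) (linExt f X))
  (cong₂ _+_ (coeff-scale w a (f u)) (coeff-linExt w f X))

linExt-congʳ : ∀ f {X X′} → X ≈ X′ → linExt f X ≈ linExt f X′
linExt-congʳ f {X} {X′} e = mk≈ λ w → trans (coeff-linExt w f X)
  (trans (pairing-congˡ (λ u → coeff w (f u)) e) (sym (coeff-linExt w f X′)))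

linExt-congˡ : ∀ {f g} X → (∀ u → f u ≈ g u) → linExt f X ≈ linExt g X
linExt-congˡ {f} {g} X e = mk≈ λ w → trans (coeff-linExt w f X)
  (trans (pairing-congʳ X (λ u → at (e u) w)) (sym (coeff-linExt w g X)))

linExt-mono : ∀ f u → linExt f (mono u) ≈ f u
linExt-mono f u = mk≈ λ w → trans (coeff-linExt w f (mono u)) (pairing-mono u (λ u → coeff w (f u)))

Linear : (Poly → Poly) → Set
Linear F = ∀ X → F X ≈ linExt (F ∘ mono) X

linExt-Linear : ∀ f → Linear (linExt f)
linExt-Linear f X = linExt-congˡ X (λ u → ≈-sym (linExt-mono f u))

id-Linear : Linear (λ X → X)
id-Linear X = mk≈ λ w → trans (coeff-pairing w X) (sym (coeff-linExt w mono X))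

Linear⇒cong : ∀ {F} → Linear F → ∀ {X X′} → X ≈ X′ → F X ≈ F X′
Linear⇒cong {F} lin {X} {X′} e =
  ≈-trans (lin X) (≈-trans (linExt-congʳ (F ∘ mono) e) (≈-sym (lin X′)))

Linear-ext : ∀ {F G} → Linear F → Linear G → (∀ u → F (mono u) ≈ G (mono u)) → ∀ X → F X ≈ G X
Linear-ext linF linG e X = ≈-trans (linF X) (≈-trans (linExt-congˡ X e) (≈-sym (linG X)))

Linear⇒⊕ : ∀ {F} → Linear F → ∀ X Y → F (X ⊕ Y) ≈ F X ⊕ F Y
Linear⇒⊕ {F} lin X Y = ≈-trans (lin (X ⊕ Y)) (≈-trans (mk≈ λ w → begin
    coeff w (linExt (F ∘ mono) (X ⊕ Y))
      ≡⟨ coeff-linExt w (F ∘ mono) (X ⊕ Y) ⟩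
    pairing (X ⊕ Y) (λ u → coeff w (F (mono u)))
      ≡⟨ pairing-++ X Y _ ⟩
    pairing X (λ u → coeff w (F (mono u))) + pairing Y (λ u → coeff w (F (mono u)))
      ≡⟨ cong₂ _+_ (coeff-linExt w (F ∘ mono) X) (coeff-linExt w (F ∘ mono) Y) ⟨
    coeff w (linExt (F ∘ mono) X) + coeff w (linExt (F ∘ mono) Y)
      ≡⟨ coeff-++ w (linExt (F ∘ mono) X) (linExt (F ∘ mono) Y) ⟨
    coeff w (linExt (F ∘ mono) X ⊕ linExt (F ∘ mono) Y) ∎)
  (⊕-cong (≈-sym (lin X)) (≈-sym (lin Y))))
  where open ≡-Reasoning

Linear⇒scale : ∀ {F} → Linear F → ∀ k X → F (scale k X) ≈ scale k (F X)
Linear⇒scale {F} lin k X = ≈-trans (lin (scale k X)) (≈-trans (mk≈ λ w → begin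
    coeff w (linExt (F ∘ mono) (scale k X))
      ≡⟨ coeff-linExt w (F ∘ mono) (scale k X) ⟩
    pairing (scale k X) (λ u → coeff w (F (mono u)))
      ≡⟨ pairing-scale k X _ ⟩
    k * pairing X (λ u → coeff w (F (mono u)))
      ≡⟨ cong (k *_) (coeff-linExt w (F ∘ mono) X) ⟨
    k * coeff w (linExt (F ∘ mono) X)
      ≡⟨ coeff-scale w k (linExt (F ∘ mono) X) ⟨
    coeff w (scale k (linExt (F ∘ mono) X)) ∎)
  (scale-cong k (≈-sym (lin X))))
  where open ≡-Reasoning

pairing-linExt : ∀ g X h → pairing (linExt g X) h ≡ pairing X (λ u → pairing (g u) h)
pairing-linExt g [] h = refl
pairing-linExt g ((a , u) ∷ X) h = trans (pairing-++ (scale a (g u)) (linExt g X) h)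
  (cong₂ _+_ (pairing-scale a (g u) h) (pairing-linExt g X h))

linExt-∘ : ∀ f g X → linExt f (linExt g X) ≈ linExt (linExt f ∘ g) X
linExt-∘ f g X = mk≈ λ w → begin
  coeff w (linExt f (linExt g X))                      ≡⟨ coeff-linExt w f (linExt g X) ⟩
  pairing (linExt g X) (λ u → coeff w (f u))           ≡⟨ pairing-linExt g X _ ⟩
  pairing X (λ u → pairing (g u) (λ v → coeff w (f v))) ≡⟨ pairing-congʳ X (λ u → coeff-linExt w f (g u)) ⟨
  pairing X (λ u → coeff w (linExt f (g u)))           ≡⟨ coeff-linExt w (linExt f ∘ g) X ⟨
  coeff w (linExt (linExt f ∘ g) X)                    ∎
  where open ≡-Reasoning

∘-Linear : ∀ {F G} → Linear F → Linear G → Linear (F ∘ G)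
∘-Linear {F} {G} linF linG X = begin
  F (G X)                                         ≈⟨ Linear⇒cong linF (linG X) ⟩
  F (linExt (G ∘ mono) X)                         ≈⟨ linF _ ⟩
  linExt (F ∘ mono) (linExt (G ∘ mono) X)         ≈⟨ linExt-∘ (F ∘ mono) (G ∘ mono) X ⟩
  linExt (linExt (F ∘ mono) ∘ G ∘ mono) X         ≈⟨ linExt-congˡ X (λ u → ≈-sym (linF (G (mono u)))) ⟩
  linExt (F ∘ G ∘ mono) X                         ∎
  where open ≈-Reasoning

⊕-Linear : ∀ {F G} → Linear F → Linear G → Linear (λ X → F X ⊕ G X)
⊕-Linear {F} {G} linF linG X = ≈-trans (⊕-cong (linF X) (linG X)) (mk≈ λ w → begin
  coeff w (linExt (F ∘ mono) X ⊕ linExt (G ∘ mono) X)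
    ≡⟨ coeff-++ w (linExt (F ∘ mono) X) (linExt (G ∘ mono) X) ⟩
  coeff w (linExt (F ∘ mono) X) + coeff w (linExt (G ∘ mono) X)
    ≡⟨ cong₂ _+_ (coeff-linExt w (F ∘ mono) X) (coeff-linExt w (G ∘ mono) X) ⟩
  pairing X (λ u → coeff w (F (mono u))) + pairing X (λ u → coeff w (G (mono u)))
    ≡⟨ pairing-+ʳ X _ _ ⟨
  pairing X (λ u → coeff w (F (mono u)) + coeff w (G (mono u)))
    ≡⟨ pairing-congʳ X (λ u → coeff-++ w (F (mono u)) (G (mono u))) ⟨
  pairing X (λ u → coeff w (F (mono u) ⊕ G (mono u)))
    ≡⟨ coeff-linExt w (λ u → F (mono u) ⊕ G (mono u)) X ⟨
  coeff w (linExt (λ u → F (mono u) ⊕ G (mono u)) X) ∎)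
  where open ≡-Reasoning

scale-Linear : ∀ {F} k → Linear F → Linear (scale k ∘ F)
scale-Linear {F} k linF X = ≈-trans (scale-cong k (linF X)) (mk≈ λ w → begin
  coeff w (scale k (linExt (F ∘ mono) X))
    ≡⟨ coeff-scale w k (linExt (F ∘ mono) X) ⟩
  k * coeff w (linExt (F ∘ mono) X)
    ≡⟨ cong (k *_) (coeff-linExt w (F ∘ mono) X) ⟩
  k * pairing X (λ u → coeff w (F (mono u)))
    ≡⟨ pairing-*ʳ X k _ ⟨
  pairing X (λ u → k * coeff w (F (mono u)))
    ≡⟨ pairing-congʳ X (λ u → coeff-scale w k (F (mono u))) ⟨
  pairing X (λ u → coeff w (scale k (F (mono u))))
    ≡⟨ coeff-linExt w (scale k ∘ F ∘ mono) X ⟨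
  coeff w (linExt (scale k ∘ F ∘ mono) X) ∎)
  where open ≡-Reasoning

⊖-Linear : ∀ {F G} → Linear F → Linear G → Linear (λ X → F X ⊖ G X)
⊖-Linear linF linG = ⊕-Linear linF (scale-Linear (- 1ℚ) linG)

·ℓ-Linear : ∀ l → Linear (_·ℓ l)
·ℓ-Linear l [] = ≈-refl
·ℓ-Linear l ((a , u) ∷ X) = ∷-cong (sym (*-identityʳ a)) (·ℓ-Linear l X)

coeff-⋄ : ∀ w A B → coeff w (A ⋄ B) ≡ pairing A (λ u → pairing B (λ v → coeff w (u ⋄w v)))
coeff-⋄ w [] B = refl
coeff-⋄ w ((a , u) ∷ A) B =
  trans (coeff-++ w (row B) (A ⋄ B)) (cong₂ _+_ (coeff-row B) (coeff-⋄ w A B))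
  where
  row : Poly → Poly
  row = concatMap (λ (b , v) → scale (a * b) (u ⋄w v))
  coeff-row : ∀ B → coeff w (row B) ≡ a * pairing B (λ v → coeff w (u ⋄w v))
  coeff-row [] = sym (*-zeroʳ a)
  coeff-row ((b , v) ∷ B) = trans (coeff-++ w (scale (a * b) (u ⋄w v)) (row B))
    (trans (cong₂ _+_ (coeff-scale w (a * b) (u ⋄w v)) (coeff-row B))
      (solve 4 (λ a b c s → a :* b :* c :+ a :* s := a :* (b :* c :+ s)) refl a b _ _))

⋄-Linearˡ : ∀ B → Linear (_⋄ B)
⋄-Linearˡ B A = mk≈ λ w → begin
  coeff w (A ⋄ B)
    ≡⟨ coeff-⋄ w A B ⟩
  pairing A (λ u → pairing B (λ v → coeff w (u ⋄w v)))
    ≡⟨ pairing-congʳ A (λ u → trans (coeff-⋄ w (mono u) B)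
                                     (pairing-mono u (λ u → pairing B (λ v → coeff w (u ⋄w v))))) ⟨
  pairing A (λ u → coeff w (mono u ⋄ B))
    ≡⟨ coeff-linExt w ((_⋄ B) ∘ mono) A ⟨
  coeff w (linExt ((_⋄ B) ∘ mono) A) ∎
  where open ≡-Reasoning

⋄-Linearʳ : ∀ A → Linear (A ⋄_)
⋄-Linearʳ A B = mk≈ λ w → begin
  coeff w (A ⋄ B)
    ≡⟨ coeff-⋄ w A B ⟩
  pairing A (λ u → pairing B (λ v → coeff w (u ⋄w v)))
    ≡⟨ pairing-swap A B _ ⟩
  pairing B (λ v → pairing A (λ u → coeff w (u ⋄w v)))
    ≡⟨ pairing-congʳ B (λ v → trans (coeff-⋄ w A (mono v))
                                     (pairing-congʳ A (λ u → pairing-mono v (λ v → coeff w (u ⋄w v))))) ⟨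
  pairing B (λ v → coeff w (A ⋄ mono v))
    ≡⟨ coeff-linExt w ((A ⋄_) ∘ mono) B ⟨
  coeff w (linExt ((A ⋄_) ∘ mono) B) ∎
  where open ≡-Reasoning

bilinear-ext : (F G : Poly → Poly → Poly) →
  (∀ B → Linear (λ A → F A B)) → (∀ A → Linear (F A)) →
  (∀ B → Linear (λ A → G A B)) → (∀ A → Linear (G A)) →
  (∀ a b → F (mono a) (mono b) ≈ G (mono a) (mono b)) → ∀ A B → F A B ≈ G A B
bilinear-ext F G linF₁ linF₂ linG₁ linG₂ e A B =
  Linear-ext (linF₁ B) (linG₁ B) (λ a → Linear-ext (linF₂ (mono a)) (linG₂ (mono a)) (e a) B) A

⋄-congˡ : ∀ {u u′} v → u ≈ u′ → u ⋄ v ≈ u′ ⋄ v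
⋄-congˡ v = Linear⇒cong (⋄-Linearˡ v)

⋄-congʳ : ∀ u {v v′} → v ≈ v′ → u ⋄ v ≈ u ⋄ v′
⋄-congʳ u = Linear⇒cong (⋄-Linearʳ u)

⋄-cong : ∀ {u u′ v v′} → u ≈ u′ → v ≈ v′ → u ⋄ v ≈ u′ ⋄ v′
⋄-cong {u′ = u′} {v = v} e f = ≈-trans (⋄-congˡ v e) (⋄-congʳ u′ f)

-- Identities in the free abelian group on words following finitely many atoms

-- Both sides are normalised to signed summands ± ρᵢ·c, which must cancel in pairs; before
-- that, atoms may be rewritten by proved rules ρᵢ ≈ ⟦ e ⟧ ρ.

infixl 6 _⊞_ _⊟_
infixl 8 _ˣ _ʸ _ᶻ _ᶻ⁺ʸ

data Expr (n : ℕ) : Set where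
  var     : Fin n → Expr n
  _⊞_ _⊟_ : Expr n → Expr n → Expr n
  _ˣ _ʸ   : Expr n → Expr n

_ᶻ : ∀ {n} → Expr n → Expr n
e ᶻ = e ˣ ⊞ e ʸ

_ᶻ⁺ʸ : ∀ {n} → Expr n → Expr n
e ᶻ⁺ʸ = e ʸ ⊞ e ᶻ

⟦_⟧ : ∀ {n} → Expr n → Vec Poly n → Poly
⟦ var i ⟧ ρ = lookup ρ i
⟦ e ⊞ f ⟧ ρ = ⟦ e ⟧ ρ ⊕ ⟦ f ⟧ ρ
⟦ e ⊟ f ⟧ ρ = ⟦ e ⟧ ρ ⊖ ⟦ f ⟧ ρ
⟦ e ˣ ⟧ ρ = ⟦ e ⟧ ρ ·ℓ lx
⟦ e ʸ ⟧ ρ = ⟦ e ⟧ ρ ·ℓ ly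

-- (s , c , i) stands for ± ρᵢ·c, with sign + iff s = true.
Summand : ℕ → Set
Summand n = Bool × Word × Fin n

_·w_ : Poly → Word → Poly
p ·w [] = p
p ·w (l ∷ c) = (p ·w c) ·ℓ l

signed : Bool → Poly → Poly
signed true p = p
signed false p = negP p

⟦_⟧ₛ : ∀ {n} → Summand n → Vec Poly n → Poly
⟦ s , c , i ⟧ₛ ρ = signed s (lookup ρ i ·w c)

Σ⟦_⟧ : ∀ {n} → List (Summand n) → Vec Poly n → Poly
Σ⟦ [] ⟧ ρ = 0P
Σ⟦ t ∷ ts ⟧ ρ = ⟦ t ⟧ₛ ρ ⊕ Σ⟦ ts ⟧ ρ

negate : ∀ {n} → Summand n → Summand n
negate (s , c , i) = not s , c , i

append : ∀ {n} → Letter → Summand n → Summand n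
append l (s , c , i) = s , l ∷ c , i

normalise : ∀ {n} → Expr n → List (Summand n)
normalise (var i) = (true , [] , i) ∷ []
normalise (e ⊞ f) = normalise e ++ normalise f
normalise (e ⊟ f) = normalise e ++ map negate (normalise f)
normalise (e ˣ) = map (append lx) (normalise e)
normalise (e ʸ) = map (append ly) (normalise e)

module _ {n} (ρ : Vec Poly n) where

  Σ-++ : ∀ ts us → Σ⟦ ts ++ us ⟧ ρ ≈ Σ⟦ ts ⟧ ρ ⊕ Σ⟦ us ⟧ ρ
  Σ-++ [] us = ≈-refl
  Σ-++ (t ∷ ts) us = ≈-trans (⊕-cong (≈-refl {⟦ t ⟧ₛ ρ}) (Σ-++ ts us)) (≈-sym (⊕-assoc (⟦ t ⟧ₛ ρ) _ _))

  Σ-negate : ∀ ts → Σ⟦ map negate ts ⟧ ρ ≈ negP (Σ⟦ ts ⟧ ρ)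
  Σ-negate [] = ≈-refl
  Σ-negate (t ∷ ts) =
    ≈-trans (⊕-cong (negate-sound t) (Σ-negate ts)) (≈-reflexive (sym (map-++ _ (⟦ t ⟧ₛ ρ) _)))
    where
    negate-sound : ∀ t → ⟦ negate t ⟧ₛ ρ ≈ negP (⟦ t ⟧ₛ ρ)
    negate-sound (true , c , i) = ≈-refl
    negate-sound (false , c , i) = ≈-sym (negP-involutive _)

  Σ-append : ∀ l ts → Σ⟦ map (append l) ts ⟧ ρ ≈ Σ⟦ ts ⟧ ρ ·ℓ l
  Σ-append l [] = ≈-refl
  Σ-append l (t ∷ ts) =
    ≈-trans (⊕-cong (append-sound t) (Σ-append l ts)) (≈-reflexive (sym (map-++ _ (⟦ t ⟧ₛ ρ) _)))
    where
    append-sound : ∀ t → ⟦ append l t ⟧ₛ ρ ≈ ⟦ t ⟧ₛ ρ ·ℓ l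
    append-sound (true , c , i) = ≈-refl
    append-sound (false , c , i) = ≈-sym (Linear⇒scale (·ℓ-Linear l) (- 1ℚ) _)

  normalise-sound : ∀ e → ⟦ e ⟧ ρ ≈ Σ⟦ normalise e ⟧ ρ
  normalise-sound (var i) = ≈-sym (⊕-identityʳ _)
  normalise-sound (e ⊞ f) = ≈-trans (⊕-cong (normalise-sound e) (normalise-sound f))
    (≈-sym (Σ-++ (normalise e) (normalise f)))
  normalise-sound (e ⊟ f) = ≈-trans (⊖-cong (normalise-sound e) (normalise-sound f))
    (≈-sym (≈-trans (Σ-++ (normalise e) _) (⊕-cong ≈-refl (Σ-negate (normalise f)))))
  normalise-sound (e ˣ) =
    ≈-trans (Linear⇒cong (·ℓ-Linear lx) (normalise-sound e)) (≈-sym (Σ-append lx (normalise e)))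
  normalise-sound (e ʸ) =
    ≈-trans (Linear⇒cong (·ℓ-Linear ly) (normalise-sound e)) (≈-sym (Σ-append ly (normalise e)))

_≟ₛ_ : ∀ {n} (t u : Summand n) → Dec (t ≡ u)
_≟ₛ_ = ≡-dec Bool._≟_ (≡-dec _≟w_ Fin._≟_)

remove : ∀ {n} → Summand n → List (Summand n) → Maybe (List (Summand n))
remove t [] = nothing
remove t (u ∷ us) with t ≟ₛ u
... | yes _ = just us
... | no _ with remove t us
...   | nothing = nothing
...   | just vs = just (u ∷ vs)

-- The fuel is the length of the list, which drops by two at each step.
cancelsWithin : ∀ {n} → ℕ → List (Summand n) → Bool
cancelsWithin _ [] = true
cancelsWithin zero (_ ∷ _) = false
cancelsWithin (suc k) (t ∷ ts) with remove (negate t) ts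
... | nothing = false
... | just us = cancelsWithin k us

cancels : ∀ {n} → List (Summand n) → Bool
cancels ts = cancelsWithin (length ts) ts

module _ {n} (ρ : Vec Poly n) where

  remove-sound : ∀ t us vs → remove t us ≡ just vs → Σ⟦ us ⟧ ρ ≈ ⟦ t ⟧ₛ ρ ⊕ Σ⟦ vs ⟧ ρ
  remove-sound t (u ∷ us) vs eq with t ≟ₛ u
  remove-sound t (t ∷ us) .us refl | yes refl = ≈-refl
  ... | no _ with remove t us in removed
  remove-sound t (u ∷ us) .(u ∷ vs) refl | no _ | just vs =
    ≈-trans (⊕-cong (≈-refl {⟦ u ⟧ₛ ρ}) (remove-sound t us vs removed))
            (⊕-leftComm (⟦ u ⟧ₛ ρ) (⟦ t ⟧ₛ ρ) (Σ⟦ vs ⟧ ρ))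

  negate-cancels : ∀ t → ⟦ t ⟧ₛ ρ ⊕ ⟦ negate t ⟧ₛ ρ ≈ 0P
  negate-cancels (true , c , i) = ⊕-inverseʳ (lookup ρ i ·w c)
  negate-cancels (false , c , i) = ⊕-inverseˡ (lookup ρ i ·w c)

  cancelsWithin-sound : ∀ k ts → cancelsWithin k ts ≡ true → Σ⟦ ts ⟧ ρ ≈ 0P
  cancelsWithin-sound _ [] _ = ≈-refl
  cancelsWithin-sound (suc k) (t ∷ ts) ok with remove (negate t) ts in removed
  ... | just us = ≈-trans (⊕-cong (≈-refl {⟦ t ⟧ₛ ρ}) (remove-sound (negate t) ts us removed))
    (≈-trans (≈-sym (⊕-assoc (⟦ t ⟧ₛ ρ) (⟦ negate t ⟧ₛ ρ) (Σ⟦ us ⟧ ρ)))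
             (⊕-cong (negate-cancels t) (cancelsWithin-sound k us ok)))

  solveFree : ∀ e₁ e₂ → cancels (normalise (e₁ ⊟ e₂)) ≡ true → ⟦ e₁ ⟧ ρ ≈ ⟦ e₂ ⟧ ρ
  solveFree e₁ e₂ ok =
    ⊖≈0⇒≈ (≈-trans (normalise-sound ρ (e₁ ⊟ e₂)) (cancelsWithin-sound _ (normalise (e₁ ⊟ e₂)) ok))

infix 4 _by_
data Rule {n} (ρ : Vec Poly n) (p : Poly) : Set where
  keep : Rule ρ p
  _by_ : (e : Expr n) → p ≈ ⟦ e ⟧ ρ → Rule ρ p

Rules : ∀ {n} → Vec Poly n → Set
Rules ρ = All (Rule ρ) ρ

module _ {n} {ρ : Vec Poly n} (rules : Rules ρ) where

  apply : ∀ {p} → Rule ρ p → Expr n → Expr n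
  apply keep e = e
  apply (e by _) _ = e

  apply-sound : ∀ {p} (r : Rule ρ p) e → p ≈ ⟦ e ⟧ ρ → p ≈ ⟦ apply r e ⟧ ρ
  apply-sound keep e eq = eq
  apply-sound (_ by eq) _ _ = eq

  rewriteOnce : Expr n → Expr n
  rewriteOnce (var i) = apply (lookup⁺ rules i) (var i)
  rewriteOnce (e ⊞ f) = rewriteOnce e ⊞ rewriteOnce f
  rewriteOnce (e ⊟ f) = rewriteOnce e ⊟ rewriteOnce f
  rewriteOnce (e ˣ) = rewriteOnce e ˣ
  rewriteOnce (e ʸ) = rewriteOnce e ʸ

  rewriteOnce-sound : ∀ e → ⟦ e ⟧ ρ ≈ ⟦ rewriteOnce e ⟧ ρ
  rewriteOnce-sound (var i) = apply-sound (lookup⁺ rules i) (var i) ≈-refl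
  rewriteOnce-sound (e ⊞ f) = ⊕-cong (rewriteOnce-sound e) (rewriteOnce-sound f)
  rewriteOnce-sound (e ⊟ f) = ⊖-cong (rewriteOnce-sound e) (rewriteOnce-sound f)
  rewriteOnce-sound (e ˣ) = Linear⇒cong (·ℓ-Linear lx) (rewriteOnce-sound e)
  rewriteOnce-sound (e ʸ) = Linear⇒cong (·ℓ-Linear ly) (rewriteOnce-sound e)

  rewriteN : ℕ → Expr n → Expr n
  rewriteN zero e = e
  rewriteN (suc k) e = rewriteN k (rewriteOnce e)

  rewriteN-sound : ∀ k e → ⟦ e ⟧ ρ ≈ ⟦ rewriteN k e ⟧ ρ
  rewriteN-sound zero e = ≈-refl
  rewriteN-sound (suc k) e = ≈-trans (rewriteOnce-sound e) (rewriteN-sound k (rewriteOnce e))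

  solveWith : ∀ k e₁ e₂ → cancels (normalise (rewriteN k e₁ ⊟ rewriteN k e₂)) ≡ true →
              ⟦ e₁ ⟧ ρ ≈ ⟦ e₂ ⟧ ρ
  solveWith k e₁ e₂ ok = ≈-trans (rewriteN-sound k e₁)
    (≈-trans (solveFree ρ (rewriteN k e₁) (rewriteN k e₂) ok) (≈-sym (rewriteN-sound k e₂)))

⊕≈⇒≈⊖ : ∀ {p q r} → p ⊕ q ≈ r → p ≈ r ⊖ q
⊕≈⇒≈⊖ {p} {q} e = ≈-trans (solveFree (p ∷ q ∷ []) ‵p (‵p ⊞ ‵q ⊟ ‵q) refl) (⊖-cong e ≈-refl)
  where
  ‵p ‵q : Expr 2
  ‵p = var (# 0)
  ‵q = var (# 1)

-- Right multiplication by letters and the product ⋄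

-- The paper's R_y, R_z and R_{z+y}, where z = x + y.
Rʸ Rᶻ Rᶻ⁺ʸ : Poly → Poly
Rʸ p = p ·ℓ ly
Rᶻ p = (p ·ℓ lx) ⊕ (p ·ℓ ly)
Rᶻ⁺ʸ p = Rʸ p ⊕ Rᶻ p

Rʸ-Linear : Linear Rʸ
Rʸ-Linear = ·ℓ-Linear ly

Rᶻ-Linear : Linear Rᶻ
Rᶻ-Linear = ⊕-Linear (·ℓ-Linear lx) (·ℓ-Linear ly)

Rᶻ⁺ʸ-Linear : Linear Rᶻ⁺ʸ
Rᶻ⁺ʸ-Linear = ⊕-Linear Rʸ-Linear Rᶻ-Linear

Rʸ-cong : ∀ {p q} → p ≈ q → Rʸ p ≈ Rʸ q
Rʸ-cong = Linear⇒cong Rʸ-Linear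

Rᶻ-cong : ∀ {p q} → p ≈ q → Rᶻ p ≈ Rᶻ q
Rᶻ-cong = Linear⇒cong Rᶻ-Linear

⋄w-[] : ∀ a → a ⋄w [] ≡ mono a
⋄w-[] [] = refl
⋄w-[] (_ ∷ _) = refl

Rᶻ-⋄w : ∀ a b → (lx ∷ a) ⋄w b ⊕ (ly ∷ a) ⋄w b ≈ Rᶻ (a ⋄w b)
Rᶻ-⋄w a [] rewrite ⋄w-[] a = ≈-refl
Rᶻ-⋄w a (lx ∷ b) =
  solveFree (a ⋄w (lx ∷ b) ∷ (ly ∷ a) ⋄w b ∷ []) ((a⋄bx ⊟ ay⋄b) ˣ ⊞ (a⋄bx ʸ ⊞ ay⋄b ˣ)) (a⋄bx ᶻ) refl
  where
  a⋄bx ay⋄b : Expr 2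
  a⋄bx = var (# 0)
  ay⋄b = var (# 1)
Rᶻ-⋄w a (ly ∷ b) =
  solveFree (a ⋄w (ly ∷ b) ∷ (lx ∷ a) ⋄w b ∷ []) ((a⋄by ˣ ⊞ ax⋄b ʸ) ⊞ (a⋄by ⊟ ax⋄b) ʸ) (a⋄by ᶻ) refl
  where
  a⋄by ax⋄b : Expr 2
  a⋄by = var (# 0)
  ax⋄b = var (# 1)

⋄w-Rᶻ : ∀ a b → a ⋄w (lx ∷ b) ⊕ a ⋄w (ly ∷ b) ≈ Rᶻ (a ⋄w b)
⋄w-Rᶻ [] b = ≈-refl
⋄w-Rᶻ (lx ∷ a) b = solveWith rules 1 ((a⋄bx ⊟ ay⋄b) ˣ ⊞ (a⋄by ˣ ⊞ ax⋄b ʸ)) (ax⋄b ᶻ) refl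
  where
  a⋄bx a⋄by ay⋄b ax⋄b a⋄b : Expr 5
  a⋄bx = var (# 0)
  a⋄by = var (# 1)
  ay⋄b = var (# 2)
  ax⋄b = var (# 3)
  a⋄b = var (# 4)
  rules : Rules (a ⋄w (lx ∷ b) ∷ a ⋄w (ly ∷ b) ∷ (ly ∷ a) ⋄w b ∷ (lx ∷ a) ⋄w b ∷ a ⋄w b ∷ [])
  rules = (a⋄b ᶻ ⊟ a⋄by by ⊕≈⇒≈⊖ (⋄w-Rᶻ a b)) ∷ keep ∷ keep
        ∷ (a⋄b ᶻ ⊟ ay⋄b by ⊕≈⇒≈⊖ (Rᶻ-⋄w a b)) ∷ keep ∷ []
⋄w-Rᶻ (ly ∷ a) b = solveWith rules 1 ((a⋄bx ʸ ⊞ ay⋄b ˣ) ⊞ (a⋄by ⊟ ax⋄b) ʸ) (ay⋄b ᶻ) refl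
  where
  a⋄bx a⋄by ay⋄b ax⋄b a⋄b : Expr 5
  a⋄bx = var (# 0)
  a⋄by = var (# 1)
  ay⋄b = var (# 2)
  ax⋄b = var (# 3)
  a⋄b = var (# 4)
  rules : Rules (a ⋄w (lx ∷ b) ∷ a ⋄w (ly ∷ b) ∷ (ly ∷ a) ⋄w b ∷ (lx ∷ a) ⋄w b ∷ a ⋄w b ∷ [])
  rules = (a⋄b ᶻ ⊟ a⋄by by ⊕≈⇒≈⊖ (⋄w-Rᶻ a b)) ∷ keep ∷ keep
        ∷ (a⋄b ᶻ ⊟ ay⋄b by ⊕≈⇒≈⊖ (Rᶻ-⋄w a b)) ∷ keep ∷ []

Rʸ-⋄w-Rʸ : ∀ a b → (ly ∷ a) ⋄w (ly ∷ b) ≈ Rʸ (a ⋄w (ly ∷ b) ⊕ (ly ∷ a) ⋄w b ⊖ Rᶻ (a ⋄w b))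
Rʸ-⋄w-Rʸ a b = solveWith rules 1 ((a⋄by ⊟ ax⋄b) ʸ) ((a⋄by ⊞ ay⋄b ⊟ a⋄b ᶻ) ʸ) refl
  where
  a⋄by ay⋄b ax⋄b a⋄b : Expr 4
  a⋄by = var (# 0)
  ay⋄b = var (# 1)
  ax⋄b = var (# 2)
  a⋄b = var (# 3)
  rules : Rules (a ⋄w (ly ∷ b) ∷ (ly ∷ a) ⋄w b ∷ (lx ∷ a) ⋄w b ∷ a ⋄w b ∷ [])
  rules = keep ∷ keep ∷ (a⋄b ᶻ ⊟ ay⋄b by ⊕≈⇒≈⊖ (Rᶻ-⋄w a b)) ∷ keep ∷ []

⋄w-y-comm : ∀ a → a ⋄w (ly ∷ []) ≈ (ly ∷ []) ⋄w a
⋄w-y-comm [] = ≈-refl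
⋄w-y-comm (lx ∷ a) = solveWith rules 1 (a⋄y ˣ ⊞ ‵a ˣ ʸ) (‵a ˣ ʸ ⊞ y⋄a ˣ) refl
  where
  a⋄y y⋄a ‵a : Expr 3
  a⋄y = var (# 0)
  y⋄a = var (# 1)
  ‵a = var (# 2)
  rules : Rules (a ⋄w (ly ∷ []) ∷ (ly ∷ []) ⋄w a ∷ mono a ∷ [])
  rules = (y⋄a by ⋄w-y-comm a) ∷ keep ∷ keep ∷ []
⋄w-y-comm (ly ∷ a) = solveWith rules 1 ((a⋄y ⊟ ‵a ˣ) ʸ) ((‵a ʸ ⊟ x⋄a) ʸ) refl
  where
  a⋄y y⋄a ‵a x⋄a : Expr 4
  a⋄y = var (# 0)
  y⋄a = var (# 1)
  ‵a = var (# 2)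
  x⋄a = var (# 3)
  rules : Rules (a ⋄w (ly ∷ []) ∷ (ly ∷ []) ⋄w a ∷ mono a ∷ (lx ∷ []) ⋄w a ∷ [])
  rules = (y⋄a by ⋄w-y-comm a) ∷ keep ∷ keep ∷ (‵a ᶻ ⊟ y⋄a by ⊕≈⇒≈⊖ (Rᶻ-⋄w [] a)) ∷ []

mono-⋄ : ∀ a b → mono a ⋄ mono b ≈ a ⋄w b
mono-⋄ a b = mk≈ λ w → trans (coeff-⋄ w (mono a) (mono b))
  (trans (pairing-mono a (λ u → pairing (mono b) (λ v → coeff w (u ⋄w v))))
         (pairing-mono b (λ v → coeff w (a ⋄w v))))

Rᶻ-⋄ : ∀ u v → Rᶻ u ⋄ v ≈ Rᶻ (u ⋄ v)
Rᶻ-⋄ = bilinear-ext (λ u v → Rᶻ u ⋄ v) (λ u v → Rᶻ (u ⋄ v))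
  (λ v → ∘-Linear (⋄-Linearˡ v) Rᶻ-Linear) (λ u → ⋄-Linearʳ (Rᶻ u))
  (λ v → ∘-Linear Rᶻ-Linear (⋄-Linearˡ v)) (λ u → ∘-Linear Rᶻ-Linear (⋄-Linearʳ u))
  λ a b → begin
    Rᶻ (mono a) ⋄ mono b
      ≈⟨ Linear⇒⊕ (⋄-Linearˡ (mono b)) (mono (lx ∷ a)) (mono (ly ∷ a)) ⟩
    mono (lx ∷ a) ⋄ mono b ⊕ mono (ly ∷ a) ⋄ mono b
      ≈⟨ ⊕-cong (mono-⋄ (lx ∷ a) b) (mono-⋄ (ly ∷ a) b) ⟩
    (lx ∷ a) ⋄w b ⊕ (ly ∷ a) ⋄w b
      ≈⟨ Rᶻ-⋄w a b ⟩
    Rᶻ (a ⋄w b)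
      ≈⟨ Rᶻ-cong (mono-⋄ a b) ⟨
    Rᶻ (mono a ⋄ mono b) ∎
  where open ≈-Reasoning

⋄-Rᶻ : ∀ u v → u ⋄ Rᶻ v ≈ Rᶻ (u ⋄ v)
⋄-Rᶻ = bilinear-ext (λ u v → u ⋄ Rᶻ v) (λ u v → Rᶻ (u ⋄ v))
  (λ v → ⋄-Linearˡ (Rᶻ v)) (λ u → ∘-Linear (⋄-Linearʳ u) Rᶻ-Linear)
  (λ v → ∘-Linear Rᶻ-Linear (⋄-Linearˡ v)) (λ u → ∘-Linear Rᶻ-Linear (⋄-Linearʳ u))
  λ a b → begin
    mono a ⋄ Rᶻ (mono b)
      ≈⟨ Linear⇒⊕ (⋄-Linearʳ (mono a)) (mono (lx ∷ b)) (mono (ly ∷ b)) ⟩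
    mono a ⋄ mono (lx ∷ b) ⊕ mono a ⋄ mono (ly ∷ b)
      ≈⟨ ⊕-cong (mono-⋄ a (lx ∷ b)) (mono-⋄ a (ly ∷ b)) ⟩
    a ⋄w (lx ∷ b) ⊕ a ⋄w (ly ∷ b)
      ≈⟨ ⋄w-Rᶻ a b ⟩
    Rᶻ (a ⋄w b)
      ≈⟨ Rᶻ-cong (mono-⋄ a b) ⟨
    Rᶻ (mono a ⋄ mono b) ∎
  where open ≈-Reasoning

Rᶻ⁺ʸ-⋄ : ∀ u v → Rᶻ⁺ʸ u ⋄ v ≈ Rʸ u ⋄ v ⊕ Rᶻ (u ⋄ v)
Rᶻ⁺ʸ-⋄ u v = ≈-trans (Linear⇒⊕ (⋄-Linearˡ v) (Rʸ u) (Rᶻ u)) (⊕-cong ≈-refl (Rᶻ-⋄ u v))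

⋄-Rᶻ⁺ʸ : ∀ u v → u ⋄ Rᶻ⁺ʸ v ≈ u ⋄ Rʸ v ⊕ Rᶻ (u ⋄ v)
⋄-Rᶻ⁺ʸ u v = ≈-trans (Linear⇒⊕ (⋄-Linearʳ u) (Rʸ v) (Rᶻ v)) (⊕-cong ≈-refl (⋄-Rᶻ u v))

Rʸ-⋄-Rʸ : ∀ u v → Rʸ u ⋄ Rʸ v ≈ Rʸ (u ⋄ Rʸ v ⊕ Rʸ u ⋄ v ⊖ Rᶻ (u ⋄ v))
Rʸ-⋄-Rʸ = bilinear-ext (λ u v → Rʸ u ⋄ Rʸ v) (λ u v → Rʸ (u ⋄ Rʸ v ⊕ Rʸ u ⋄ v ⊖ Rᶻ (u ⋄ v)))
  (λ v → ∘-Linear (⋄-Linearˡ (Rʸ v)) Rʸ-Linear) (λ u → ∘-Linear (⋄-Linearʳ (Rʸ u)) Rʸ-Linear)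
  (λ v → ∘-Linear Rʸ-Linear (⊖-Linear (⊕-Linear (⋄-Linearˡ (Rʸ v)) (∘-Linear (⋄-Linearˡ v) Rʸ-Linear))
                                      (∘-Linear Rᶻ-Linear (⋄-Linearˡ v))))
  (λ u → ∘-Linear Rʸ-Linear (⊖-Linear (⊕-Linear (∘-Linear (⋄-Linearʳ u) Rʸ-Linear) (⋄-Linearʳ (Rʸ u)))
                                      (∘-Linear Rᶻ-Linear (⋄-Linearʳ u))))
  λ a b → begin
    mono (ly ∷ a) ⋄ mono (ly ∷ b)
      ≈⟨ mono-⋄ (ly ∷ a) (ly ∷ b) ⟩
    (ly ∷ a) ⋄w (ly ∷ b)
      ≈⟨ Rʸ-⋄w-Rʸ a b ⟩
    Rʸ (a ⋄w (ly ∷ b) ⊕ (ly ∷ a) ⋄w b ⊖ Rᶻ (a ⋄w b))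
      ≈⟨ Rʸ-cong (⊖-cong (⊕-cong (mono-⋄ a (ly ∷ b)) (mono-⋄ (ly ∷ a) b)) (Rᶻ-cong (mono-⋄ a b))) ⟨
    Rʸ (mono a ⋄ mono (ly ∷ b) ⊕ mono (ly ∷ a) ⋄ mono b ⊖ Rᶻ (mono a ⋄ mono b)) ∎
  where open ≈-Reasoning

⋄-y-comm : ∀ u → u ⋄ yP ≈ yP ⋄ u
⋄-y-comm = Linear-ext (⋄-Linearˡ yP) (⋄-Linearʳ yP) λ a → begin
  mono a ⋄ yP         ≈⟨ mono-⋄ a (ly ∷ []) ⟩
  a ⋄w (ly ∷ [])      ≈⟨ ⋄w-y-comm a ⟩
  (ly ∷ []) ⋄w a      ≈⟨ mono-⋄ (ly ∷ []) a ⟨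
  yP ⋄ mono a         ∎
  where open ≈-Reasoning

⋄-identityˡ : ∀ u → 1P ⋄ u ≈ u
⋄-identityˡ u = ≈-sym (Linear-ext id-Linear (⋄-Linearʳ 1P) (λ a → ≈-sym (mono-⋄ [] a)) u)

⋄-identityʳ : ∀ u → u ⋄ 1P ≈ u
⋄-identityʳ u = ≈-sym (Linear-ext id-Linear (⋄-Linearˡ 1P)
  (λ a → ≈-sym (≈-trans (mono-⋄ a []) (≈-reflexive (⋄w-[] a)))) u)

⋄-zeroʳ : ∀ u → u ⋄ 0P ≈ 0P
⋄-zeroʳ u = mk≈ λ w → trans (coeff-⋄ w u 0P) (pairing-0ʳ u)

y⋄Rʸ : ∀ k → yP ⋄ Rʸ k ≈ Rʸ (Rʸ k ⊕ yP ⋄ k ⊖ Rᶻ k)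
y⋄Rʸ k = ≈-trans (Rʸ-⋄-Rʸ 1P k)
  (Rʸ-cong (⊖-cong (⊕-cong (⋄-identityˡ (Rʸ k)) ≈-refl) (Rᶻ-cong (⋄-identityˡ k))))

-- The operator R

R-Linear : Linear R
R-Linear = linExt-Linear Rw

R-cong : ∀ {p q} → p ≈ q → R p ≈ R q
R-cong = Linear⇒cong R-Linear

R-1 : R 1P ≈ yP
R-1 = linExt-mono Rw []

split-2ℚ : ∀ v w → ((1ℚ , v) ∷ (2ℚ , w) ∷ []) ≈ ((1ℚ , w) ∷ (1ℚ , v) ∷ (1ℚ , w) ∷ [])
split-2ℚ v w = mk≈ λ u → trans (coeff-pairing u ((1ℚ , v) ∷ (2ℚ , w) ∷ []))
  (trans (solve 2 (λ a b → con 1ℚ :* a :+ ((con 1ℚ :+ con 1ℚ) :* b :+ con 0ℚ)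
                         := con 1ℚ :* b :+ (con 1ℚ :* a :+ (con 1ℚ :* b :+ con 0ℚ)))
                  refl (coeff u (mono v)) (coeff u (mono w)))
         (sym (coeff-pairing u ((1ℚ , w) ∷ (1ℚ , v) ∷ (1ℚ , w) ∷ []))))

R-Rʸ : ∀ m → R (Rʸ m) ≈ Rʸ (Rᶻ⁺ʸ m)
R-Rʸ = Linear-ext (∘-Linear R-Linear Rʸ-Linear) (∘-Linear Rʸ-Linear Rᶻ⁺ʸ-Linear) λ u →
  ≈-trans (linExt-mono Rw (ly ∷ u)) (split-2ℚ (ly ∷ lx ∷ u) (ly ∷ ly ∷ u))

R-power-Rʸ : ∀ a → Σ Poly λ p → iter (suc a) R 1P ≈ Rʸ p
R-power-Rʸ zero = 1P , R-1
R-power-Rʸ (suc a) with R-power-Rʸ a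
... | p , e = Rᶻ⁺ʸ p , ≈-trans (R-cong e) (R-Rʸ p)

-- The coefficient identity on 𝔥¹

Rʸ-⋄-RRʸ : ∀ p q → Rʸ p ⋄ R (Rʸ q)
  ≈ Rʸ (p ⋄ R (Rʸ q) ⊕ (Rʸ p ⋄ Rʸ q ⊕ Rᶻ (Rʸ p ⋄ q)) ⊖ Rᶻ (p ⋄ Rʸ q ⊕ Rᶻ (p ⋄ q)))
Rʸ-⋄-RRʸ p q = begin
  Rʸ p ⋄ R (Rʸ q)
    ≈⟨ ⋄-congʳ (Rʸ p) (R-Rʸ q) ⟩
  Rʸ p ⋄ Rʸ (Rᶻ⁺ʸ q)
    ≈⟨ Rʸ-⋄-Rʸ p (Rᶻ⁺ʸ q) ⟩
  Rʸ (p ⋄ Rʸ (Rᶻ⁺ʸ q) ⊕ Rʸ p ⋄ Rᶻ⁺ʸ q ⊖ Rᶻ (p ⋄ Rᶻ⁺ʸ q))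
    ≈⟨ Rʸ-cong (⊖-cong (⊕-cong (⋄-congʳ p (≈-sym (R-Rʸ q))) (⋄-Rᶻ⁺ʸ (Rʸ p) q))
                       (Rᶻ-cong (⋄-Rᶻ⁺ʸ p q))) ⟩
  Rʸ (p ⋄ R (Rʸ q) ⊕ (Rʸ p ⋄ Rʸ q ⊕ Rᶻ (Rʸ p ⋄ q)) ⊖ Rᶻ (p ⋄ Rʸ q ⊕ Rᶻ (p ⋄ q))) ∎
  where open ≈-Reasoning

RRʸ-⋄-Rʸ : ∀ p q → R (Rʸ p) ⋄ Rʸ q
  ≈ Rʸ ((Rʸ p ⋄ Rʸ q ⊕ Rᶻ (p ⋄ Rʸ q)) ⊕ R (Rʸ p) ⋄ q ⊖ Rᶻ (Rʸ p ⋄ q ⊕ Rᶻ (p ⋄ q)))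
RRʸ-⋄-Rʸ p q = begin
  R (Rʸ p) ⋄ Rʸ q
    ≈⟨ ⋄-congˡ (Rʸ q) (R-Rʸ p) ⟩
  Rʸ (Rᶻ⁺ʸ p) ⋄ Rʸ q
    ≈⟨ Rʸ-⋄-Rʸ (Rᶻ⁺ʸ p) q ⟩
  Rʸ (Rᶻ⁺ʸ p ⋄ Rʸ q ⊕ Rʸ (Rᶻ⁺ʸ p) ⋄ q ⊖ Rᶻ (Rᶻ⁺ʸ p ⋄ q))
    ≈⟨ Rʸ-cong (⊖-cong (⊕-cong (Rᶻ⁺ʸ-⋄ p (Rʸ q)) (⋄-congˡ q (≈-sym (R-Rʸ p))))
                       (Rᶻ-cong (Rᶻ⁺ʸ-⋄ p q))) ⟩
  Rʸ ((Rʸ p ⋄ Rʸ q ⊕ Rᶻ (p ⋄ Rʸ q)) ⊕ R (Rʸ p) ⋄ q ⊖ Rᶻ (Rʸ p ⋄ q ⊕ Rᶻ (p ⋄ q))) ∎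
  where open ≈-Reasoning

RRʸ-⋄-RRʸ : ∀ p q → R (Rʸ p) ⋄ R (Rʸ q)
  ≈ Rʸ ((Rʸ p ⋄ R (Rʸ q) ⊕ Rᶻ (p ⋄ R (Rʸ q))) ⊕ (R (Rʸ p) ⋄ Rʸ q ⊕ Rᶻ (R (Rʸ p) ⋄ q))
        ⊖ Rᶻ ((Rʸ p ⋄ Rʸ q ⊕ Rᶻ (Rʸ p ⋄ q)) ⊕ Rᶻ (p ⋄ Rʸ q ⊕ Rᶻ (p ⋄ q))))
RRʸ-⋄-RRʸ p q = begin
  R (Rʸ p) ⋄ R (Rʸ q)
    ≈⟨ ⋄-cong (R-Rʸ p) (R-Rʸ q) ⟩
  Rʸ (Rᶻ⁺ʸ p) ⋄ Rʸ (Rᶻ⁺ʸ q)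
    ≈⟨ Rʸ-⋄-Rʸ (Rᶻ⁺ʸ p) (Rᶻ⁺ʸ q) ⟩
  Rʸ (Rᶻ⁺ʸ p ⋄ Rʸ (Rᶻ⁺ʸ q) ⊕ Rʸ (Rᶻ⁺ʸ p) ⋄ Rᶻ⁺ʸ q ⊖ Rᶻ (Rᶻ⁺ʸ p ⋄ Rᶻ⁺ʸ q))
    ≈⟨ Rʸ-cong (⊖-cong (⊕-cong (≈-trans (⋄-congʳ (Rᶻ⁺ʸ p) (≈-sym (R-Rʸ q))) (Rᶻ⁺ʸ-⋄ p (R (Rʸ q))))
                               (≈-trans (⋄-congˡ (Rᶻ⁺ʸ q) (≈-sym (R-Rʸ p))) (⋄-Rᶻ⁺ʸ (R (Rʸ p)) q)))
                       (Rᶻ-cong (≈-trans (Rᶻ⁺ʸ-⋄ p (Rᶻ⁺ʸ q))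
                                         (⊕-cong (⋄-Rᶻ⁺ʸ (Rʸ p) q) (Rᶻ-cong (⋄-Rᶻ⁺ʸ p q)))))) ⟩
  Rʸ ((Rʸ p ⋄ R (Rʸ q) ⊕ Rᶻ (p ⋄ R (Rʸ q))) ⊕ (R (Rʸ p) ⋄ Rʸ q ⊕ Rᶻ (R (Rʸ p) ⋄ q))
      ⊖ Rᶻ ((Rʸ p ⋄ Rʸ q ⊕ Rᶻ (Rʸ p ⋄ q)) ⊕ Rᶻ (p ⋄ Rʸ q ⊕ Rᶻ (p ⋄ q)))) ∎
  where open ≈-Reasoning

y⋄R-commutator : Poly → Poly
y⋄R-commutator W = yP ⋄ R W ⊖ R (yP ⋄ W)

y⋄R-commutator-cong : ∀ {W W′} → W ≈ W′ → y⋄R-commutator W ≈ y⋄R-commutator W′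
y⋄R-commutator-cong e = ⊖-cong (⋄-congʳ yP (R-cong e)) (R-cong (⋄-congʳ yP e))

y⋄R-commutator-Rʸ : ∀ m → y⋄R-commutator (Rʸ m) ≈ Rʸ (Rʸ (Rᶻ⁺ʸ m) ⊖ Rᶻ (Rʸ m) ⊖ Rᶻ (Rʸ m))
y⋄R-commutator-Rʸ m = solveWith rules 1 (‵y⋄RRʸm ⊟ ‵Ry⋄Rʸm) ((‵m ᶻ⁺ʸ ʸ ⊟ ‵m ʸ ᶻ ⊟ ‵m ʸ ᶻ) ʸ) refl
  where
  y⋄m : Poly
  y⋄m = yP ⋄ m

  y⋄RRʸ : yP ⋄ R (Rʸ m) ≈ Rʸ (Rʸ (Rᶻ⁺ʸ m) ⊕ (Rʸ (Rʸ m ⊕ y⋄m ⊖ Rᶻ m) ⊕ Rᶻ y⋄m) ⊖ Rᶻ (Rᶻ⁺ʸ m))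
  y⋄RRʸ = begin
    yP ⋄ R (Rʸ m)
      ≈⟨ ⋄-congʳ yP (R-Rʸ m) ⟩
    yP ⋄ Rʸ (Rᶻ⁺ʸ m)
      ≈⟨ y⋄Rʸ (Rᶻ⁺ʸ m) ⟩
    Rʸ (Rʸ (Rᶻ⁺ʸ m) ⊕ yP ⋄ Rᶻ⁺ʸ m ⊖ Rᶻ (Rᶻ⁺ʸ m))
      ≈⟨ Rʸ-cong (⊖-cong (⊕-cong (≈-refl {Rʸ (Rᶻ⁺ʸ m)})
                                 (≈-trans (⋄-Rᶻ⁺ʸ yP m) (⊕-cong (y⋄Rʸ m) (≈-refl {Rᶻ y⋄m}))))
                         (≈-refl {Rᶻ (Rᶻ⁺ʸ m)})) ⟩
    Rʸ (Rʸ (Rᶻ⁺ʸ m) ⊕ (Rʸ (Rʸ m ⊕ y⋄m ⊖ Rᶻ m) ⊕ Rᶻ y⋄m) ⊖ Rᶻ (Rᶻ⁺ʸ m)) ∎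
    where open ≈-Reasoning

  Ry⋄Rʸ : R (yP ⋄ Rʸ m) ≈ Rʸ (Rᶻ⁺ʸ (Rʸ m ⊕ y⋄m ⊖ Rᶻ m))
  Ry⋄Rʸ = ≈-trans (R-cong (y⋄Rʸ m)) (R-Rʸ (Rʸ m ⊕ y⋄m ⊖ Rᶻ m))

  ‵m ‵y⋄m ‵y⋄RRʸm ‵Ry⋄Rʸm : Expr 4
  ‵m = var (# 0)
  ‵y⋄m = var (# 1)
  ‵y⋄RRʸm = var (# 2)
  ‵Ry⋄Rʸm = var (# 3)
  rules : Rules (m ∷ y⋄m ∷ yP ⋄ R (Rʸ m) ∷ R (yP ⋄ Rʸ m) ∷ [])
  rules = keep ∷ keep
        ∷ ((‵m ᶻ⁺ʸ ʸ ⊞ ((‵m ʸ ⊞ ‵y⋄m ⊟ ‵m ᶻ) ʸ ⊞ ‵y⋄m ᶻ) ⊟ ‵m ᶻ⁺ʸ ᶻ) ʸ by y⋄RRʸ)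
        ∷ ((‵m ʸ ⊞ ‵y⋄m ⊟ ‵m ᶻ) ᶻ⁺ʸ ʸ by Ry⋄Rʸ)
        ∷ []

⋄-defect : Poly → Poly → Poly
⋄-defect U V = R U ⋄ R V ⊖ R (U ⋄ R V) ⊖ R (R U ⋄ V) ⊕ R (R (U ⋄ V))

⋄-defect-cong : ∀ {U U′ V V′} → U ≈ U′ → V ≈ V′ → ⋄-defect U V ≈ ⋄-defect U′ V′
⋄-defect-cong eU eV =
  ⊕-cong (⊖-cong (⊖-cong (⋄-cong (R-cong eU) (R-cong eV)) (R-cong (⋄-cong eU (R-cong eV))))
                 (R-cong (⋄-cong (R-cong eU) eV)))
         (R-cong (R-cong (⋄-cong eU eV)))

⋄-defect-Rʸ : ∀ p q → ⋄-defect (Rʸ p) (Rʸ q) ≈ y⋄R-commutator (Rʸ p ⋄ Rʸ q)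
⋄-defect-Rʸ p q = begin
  ⋄-defect U V
    ≈⟨ solveWith rules 3 (RU⋄RV ⊟ R[U⋄RV] ⊟ R[RU⋄V] ⊞ RR[U⋄V]) ((‵m ᶻ⁺ʸ ʸ ⊟ ‵m ʸ ᶻ ⊟ ‵m ʸ ᶻ) ʸ) refl ⟩
  Rʸ (Rʸ (Rᶻ⁺ʸ m) ⊖ Rᶻ (Rʸ m) ⊖ Rᶻ (Rʸ m))
    ≈⟨ ≈-trans (y⋄R-commutator-cong (Rʸ-⋄-Rʸ p q)) (y⋄R-commutator-Rʸ m) ⟨
  y⋄R-commutator (U ⋄ V) ∎
  where
  open ≈-Reasoning
  U V m m₁ m₂ : Poly
  U = Rʸ p
  V = Rʸ q
  m = p ⋄ V ⊕ U ⋄ q ⊖ Rᶻ (p ⋄ q)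
  m₁ = p ⋄ R V ⊕ (U ⋄ V ⊕ Rᶻ (U ⋄ q)) ⊖ Rᶻ (p ⋄ V ⊕ Rᶻ (p ⋄ q))
  m₂ = (U ⋄ V ⊕ Rᶻ (p ⋄ V)) ⊕ R U ⋄ q ⊖ Rᶻ (U ⋄ q ⊕ Rᶻ (p ⋄ q))

  p⋄q p⋄V U⋄q p⋄RV RU⋄q U⋄V U⋄RV RU⋄V RU⋄RV R[U⋄RV] R[RU⋄V] RR[U⋄V] ‵m ‵m₁ ‵m₂ : Expr 12
  p⋄q = var (# 0)
  p⋄V = var (# 1)
  U⋄q = var (# 2)
  p⋄RV = var (# 3)
  RU⋄q = var (# 4)
  U⋄V = var (# 5)
  U⋄RV = var (# 6)
  RU⋄V = var (# 7)
  RU⋄RV = var (# 8)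
  R[U⋄RV] = var (# 9)
  R[RU⋄V] = var (# 10)
  RR[U⋄V] = var (# 11)
  ‵m = p⋄V ⊞ U⋄q ⊟ p⋄q ᶻ
  ‵m₁ = p⋄RV ⊞ (U⋄V ⊞ U⋄q ᶻ) ⊟ (p⋄V ⊞ p⋄q ᶻ) ᶻ
  ‵m₂ = (U⋄V ⊞ p⋄V ᶻ) ⊞ RU⋄q ⊟ (U⋄q ⊞ p⋄q ᶻ) ᶻ

  rules : Rules (p ⋄ q ∷ p ⋄ V ∷ U ⋄ q ∷ p ⋄ R V ∷ R U ⋄ q ∷ U ⋄ V
                ∷ U ⋄ R V ∷ R U ⋄ V ∷ R U ⋄ R V ∷ R (U ⋄ R V) ∷ R (R U ⋄ V) ∷ R (R (U ⋄ V)) ∷ [])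
  rules = keep ∷ keep ∷ keep ∷ keep ∷ keep
        ∷ (‵m ʸ by Rʸ-⋄-Rʸ p q)
        ∷ (‵m₁ ʸ by Rʸ-⋄-RRʸ p q)
        ∷ (‵m₂ ʸ by RRʸ-⋄-Rʸ p q)
        ∷ (((U⋄RV ⊞ p⋄RV ᶻ) ⊞ (RU⋄V ⊞ RU⋄q ᶻ) ⊟ ((U⋄V ⊞ U⋄q ᶻ) ⊞ (p⋄V ⊞ p⋄q ᶻ) ᶻ) ᶻ) ʸ by RRʸ-⋄-RRʸ p q)
        ∷ (‵m₁ ᶻ⁺ʸ ʸ by ≈-trans (R-cong (Rʸ-⋄-RRʸ p q)) (R-Rʸ m₁))
        ∷ (‵m₂ ᶻ⁺ʸ ʸ by ≈-trans (R-cong (RRʸ-⋄-Rʸ p q)) (R-Rʸ m₂))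
        ∷ (‵m ᶻ⁺ʸ ᶻ⁺ʸ ʸ by ≈-trans (R-cong (≈-trans (R-cong (Rʸ-⋄-Rʸ p q)) (R-Rʸ m))) (R-Rʸ (Rᶻ⁺ʸ m)))
        ∷ []

⋄-defect-1ˡ : ∀ V → ⋄-defect 1P V ≈ y⋄R-commutator (1P ⋄ V)
⋄-defect-1ˡ V = begin
  R 1P ⋄ R V ⊖ R (1P ⋄ R V) ⊖ R (R 1P ⋄ V) ⊕ R (R (1P ⋄ V))
    ≈⟨ ⊕-cong (⊖-cong (⊖-cong (⋄-congˡ (R V) R-1) (R-cong (⋄-identityˡ (R V)))) (R-cong (⋄-congˡ V R-1)))
              (R-cong (R-cong (⋄-identityˡ V))) ⟩
  yP ⋄ R V ⊖ R (R V) ⊖ R (yP ⋄ V) ⊕ R (R V)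
    ≈⟨ solveFree (yP ⋄ R V ∷ R (R V) ∷ R (yP ⋄ V) ∷ []) (y⋄RV ⊟ RRV ⊟ R[y⋄V] ⊞ RRV) (y⋄RV ⊟ R[y⋄V]) refl ⟩
  yP ⋄ R V ⊖ R (yP ⋄ V)
    ≈⟨ y⋄R-commutator-cong (⋄-identityˡ V) ⟨
  y⋄R-commutator (1P ⋄ V) ∎
  where
  open ≈-Reasoning
  y⋄RV RRV R[y⋄V] : Expr 3
  y⋄RV = var (# 0)
  RRV = var (# 1)
  R[y⋄V] = var (# 2)

⋄-defect-1ʳ : ∀ U → ⋄-defect U 1P ≈ y⋄R-commutator (U ⋄ 1P)
⋄-defect-1ʳ U = begin
  R U ⋄ R 1P ⊖ R (U ⋄ R 1P) ⊖ R (R U ⋄ 1P) ⊕ R (R (U ⋄ 1P))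
    ≈⟨ ⊕-cong (⊖-cong (⊖-cong (≈-trans (⋄-congʳ (R U) R-1) (⋄-y-comm (R U)))
                               (R-cong (≈-trans (⋄-congʳ U R-1) (⋄-y-comm U))))
                      (R-cong (⋄-identityʳ (R U))))
              (R-cong (R-cong (⋄-identityʳ U))) ⟩
  yP ⋄ R U ⊖ R (yP ⋄ U) ⊖ R (R U) ⊕ R (R U)
    ≈⟨ solveFree (yP ⋄ R U ∷ R (yP ⋄ U) ∷ R (R U) ∷ []) (y⋄RU ⊟ R[y⋄U] ⊟ RRU ⊞ RRU) (y⋄RU ⊟ R[y⋄U]) refl ⟩
  yP ⋄ R U ⊖ R (yP ⋄ U)
    ≈⟨ y⋄R-commutator-cong (⋄-identityʳ U) ⟨
  y⋄R-commutator (U ⋄ 1P) ∎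
  where
  open ≈-Reasoning
  y⋄RU R[y⋄U] RRU : Expr 3
  y⋄RU = var (# 0)
  R[y⋄U] = var (# 1)
  RRU = var (# 2)

⋄-defect-powers : ∀ a b →
  ⋄-defect (iter a R 1P) (iter b R 1P) ≈ y⋄R-commutator (iter a R 1P ⋄ iter b R 1P)
⋄-defect-powers zero b = ⋄-defect-1ˡ (iter b R 1P)
⋄-defect-powers (suc a) zero = ⋄-defect-1ʳ (iter (suc a) R 1P)
⋄-defect-powers (suc a) (suc b) with R-power-Rʸ a | R-power-Rʸ b
... | p , eU | q , eV = ≈-trans (⋄-defect-cong eU eV)
  (≈-trans (⋄-defect-Rʸ p q) (y⋄R-commutator-cong (≈-sym (⋄-cong eU eV))))

-- Coefficients of the power series

concatMap-upTo-suc : ∀ n (f : ℕ → Poly) → concatMap f (upTo (suc n)) ≡ f 0 ⊕ concatMap (f ∘ suc) (upTo n)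
concatMap-upTo-suc n f = cong (f 0 ++_)
  (trans (cong (concatMap f) (sym (map-upTo suc n))) (concatMap-map f suc (upTo n)))

concatMap-upTo-null : ∀ n (f : ℕ → Poly) → (∀ i → i < n → f i ≈ 0P) → concatMap f (upTo n) ≈ 0P
concatMap-upTo-null zero f null = ≈-refl
concatMap-upTo-null (suc n) f null = ≈-trans (≈-reflexive (concatMap-upTo-suc n f))
  (⊕-cong (null 0 (s≤s z≤n)) (concatMap-upTo-null n (f ∘ suc) (λ i i<n → null (suc i) (s≤s i<n))))

concatMap-upTo-single : ∀ n k (f : ℕ → Poly) → k < n → (∀ i → i < n → i ≢ k → f i ≈ 0P) →
                        concatMap f (upTo n) ≈ f k
concatMap-upTo-single (suc n) zero f _ null = ≈-trans (≈-reflexive (concatMap-upTo-suc n f))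
  (≈-trans (⊕-cong (≈-refl {f 0}) (concatMap-upTo-null n (f ∘ suc) (λ i i<n → null (suc i) (s≤s i<n) λ ())))
           (⊕-identityʳ (f 0)))
concatMap-upTo-single (suc n) (suc k) f (s≤s k<n) null = ≈-trans (≈-reflexive (concatMap-upTo-suc n f))
  (⊕-cong (null 0 (s≤s z≤n) λ ())
          (concatMap-upTo-single n k (f ∘ suc) k<n (λ i i<n i≢k → null (suc i) (s≤s i<n) (i≢k ∘ cong pred))))

seriesB-off-axis : ∀ {a} b → 0 < a → seriesB a b ≡ 0P
seriesB-off-axis b (s≤s z≤n) = refl

A⋄B : Series
A⋄B = seriesA ⋄S seriesB

A⋄B-coeff : ∀ a b → A⋄B a b ≈ iter a R 1P ⋄ iter b R 1P
A⋄B-coeff a b =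
  ≈-trans (concatMap-upTo-single (suc a) a _ (s≤s ≤-refl) row-null)
  (≈-trans (concatMap-upTo-single (suc b) 0 _ (s≤s z≤n) column-null)
           (≈-reflexive (cong (λ c → iter a R 1P ⋄ seriesB c b) (n∸n≡0 a))))
  where
  row-null : ∀ i → i < suc a → i ≢ a →
             concatMap (λ j → seriesA i j ⋄ seriesB (a ∸ i) (b ∸ j)) (upTo (suc b)) ≈ 0P
  row-null i (s≤s i≤a) i≢a = concatMap-upTo-null (suc b) _ λ j _ →
    ≈-trans (⋄-congʳ (seriesA i j) (≈-reflexive (seriesB-off-axis (b ∸ j) (m<n⇒0<n∸m (≤∧≢⇒< i≤a i≢a)))))
            (⋄-zeroʳ (seriesA i j))
  column-null : ∀ j → j < suc b → j ≢ 0 → seriesA a j ⋄ seriesB (a ∸ a) (b ∸ j) ≈ 0P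
  column-null zero _ j≢0 with () ← j≢0 refl
  column-null (suc j) _ _ = ≈-refl

y⋄S-coeff : ∀ T a b → (constS yP ⋄S T) a b ≈ yP ⋄ T a b
y⋄S-coeff T a b =
  ≈-trans (concatMap-upTo-single (suc a) 0 _ (s≤s z≤n) row-null)
          (concatMap-upTo-single (suc b) 0 _ (s≤s z≤n) column-null)
  where
  row-null : ∀ i → i < suc a → i ≢ 0 →
             concatMap (λ j → constS yP i j ⋄ T (a ∸ i) (b ∸ j)) (upTo (suc b)) ≈ 0P
  row-null zero _ i≢0 with () ← i≢0 refl
  row-null (suc i) _ _ = concatMap-upTo-null (suc b) _ λ _ _ → ≈-refl
  column-null : ∀ j → j < suc b → j ≢ 0 → constS yP 0 j ⋄ T a (b ∸ j) ≈ 0P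
  column-null zero _ j≢0 with () ← j≢0 refl
  column-null (suc j) _ _ = ≈-refl

coefficientwise : ∀ a b →
  opRXRY A⋄B a b ≈ (constS 1P ⊕S (X· (Y· ((constS yP ⋄S RS A⋄B) ⊖S RS (constS yP ⋄S A⋄B))))) a b
coefficientwise zero zero = begin
  A⋄B 0 0 ⊖ 0P ⊖ 0P ⊕ 0P
    ≈⟨ ≈-trans (⊕-identityʳ _) (≈-trans (⊖-identityʳ (A⋄B 0 0 ⊖ 0P)) (⊖-identityʳ (A⋄B 0 0))) ⟩
  A⋄B 0 0   ≈⟨ A⋄B-coeff 0 0 ⟩
  1P ⋄ 1P   ≈⟨ ⋄-identityˡ 1P ⟩
  1P        ≈⟨ ⊕-identityʳ 1P ⟨
  1P ⊕ 0P   ∎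
  where open ≈-Reasoning
coefficientwise zero (suc b) = begin
  A⋄B 0 (suc b) ⊖ 0P ⊖ R (A⋄B 0 b) ⊕ 0P
    ≈⟨ ≈-trans (⊕-identityʳ _) (⊖-cong (⊖-identityʳ (A⋄B 0 (suc b))) (≈-refl {R (A⋄B 0 b)})) ⟩
  A⋄B 0 (suc b) ⊖ R (A⋄B 0 b)
    ≈⟨ ⊖-cong (≈-trans (A⋄B-coeff 0 (suc b)) (⋄-identityˡ (iter (suc b) R 1P)))
              (R-cong (≈-trans (A⋄B-coeff 0 b) (⋄-identityˡ (iter b R 1P)))) ⟩
  R (iter b R 1P) ⊖ R (iter b R 1P)
    ≈⟨ ⊕-inverseʳ (R (iter b R 1P)) ⟩
  0P ∎
  where open ≈-Reasoning
coefficientwise (suc a) zero = begin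
  A⋄B (suc a) 0 ⊖ R (A⋄B a 0) ⊖ 0P ⊕ 0P
    ≈⟨ ≈-trans (⊕-identityʳ _) (⊖-identityʳ (A⋄B (suc a) 0 ⊖ R (A⋄B a 0))) ⟩
  A⋄B (suc a) 0 ⊖ R (A⋄B a 0)
    ≈⟨ ⊖-cong (≈-trans (A⋄B-coeff (suc a) 0) (⋄-identityʳ (iter (suc a) R 1P)))
              (R-cong (≈-trans (A⋄B-coeff a 0) (⋄-identityʳ (iter a R 1P)))) ⟩
  R (iter a R 1P) ⊖ R (iter a R 1P)
    ≈⟨ ⊕-inverseʳ (R (iter a R 1P)) ⟩
  0P ∎
  where open ≈-Reasoning
coefficientwise (suc a) (suc b) = begin
  A⋄B (suc a) (suc b) ⊖ R (A⋄B a (suc b)) ⊖ R (A⋄B (suc a) b) ⊕ R (R (A⋄B a b))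
    ≈⟨ ⊕-cong (⊖-cong (⊖-cong (A⋄B-coeff (suc a) (suc b)) (R-cong (A⋄B-coeff a (suc b))))
                      (R-cong (A⋄B-coeff (suc a) b)))
              (R-cong (R-cong (A⋄B-coeff a b))) ⟩
  ⋄-defect U V
    ≈⟨ ⋄-defect-powers a b ⟩
  y⋄R-commutator (U ⋄ V)
    ≈⟨ ⊖-cong (≈-trans (y⋄S-coeff (RS A⋄B) a b) (⋄-congʳ yP (R-cong (A⋄B-coeff a b))))
              (R-cong (≈-trans (y⋄S-coeff A⋄B a b) (⋄-congʳ yP (A⋄B-coeff a b)))) ⟨
  (constS yP ⋄S RS A⋄B) a b ⊖ R ((constS yP ⋄S A⋄B) a b) ∎
  where
  open ≈-Reasoning
  U V : Poly
  U = iter a R 1P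
  V = iter b R 1P

proposition5p2 : opRXRY (seriesA ⋄S seriesB)
                   ≈S (constS 1P ⊕S (X· (Y· ((constS yP ⋄S RS (seriesA ⋄S seriesB))
                                             ⊖S RS (constS yP ⋄S (seriesA ⋄S seriesB))))))
proposition5p2 a b = at (coefficientwise a b)
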